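{- Let $Q$, $\mathcal{O}$, $L$ be as in the context. Suppose $\gamma$ and $\gamma_1$ are saturated chains in an interval $[u,v]_L$ (from $u$ to $v$) whose lowest cover relations (edges out of $u$) are distinct. Let $\gamma_2\neq\gamma$ be any node on the path $\gamma*\gamma_1$. Let $e_1$ be the lowest edge of $\gamma_1$, and $e_2$ the lowest edge of $\gamma_2$ not in $\gamma$. Then there is an alternating sequence $(\epsilon_0,F_1,\epsilon_1,F_2,\ldots,F_r,\epsilon_r)$ with $\epsilon_0=e_1$, $\epsilon_r=e_2$, each $\epsilon_i$ an edge of $Q$ whose lower vertex $x_i$ lies in $\gamma$, and each $F_i$ a 2-face of $Q$ containing $\epsilon_{i-1}$, $\epsilon_i$, and all edges and vertices of $\gamma$ between $x_{i-1}$ and $x_i$.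
   Context: $Q$ is a polytope, $\mathcal{O}$ a facial orientation of its 1-skeleton (acyclic, each face $F$ has a unique source $\mathrm{srce}(F)$ and sink $\mathrm{sink}(F)$), $Q$ is $\mathcal{O}$-directionally simple (for each vertex $x$ and each subset $E$ of edges directed out of $x$ there is a distinct $|E|$-face containing $x$ and $E$), and $\mathcal{O}$ is the Hasse diagram of a lattice $L$ on the vertices of $Q$; chains are identified with directed paths and their edges. A move across a 2-face $F$ replaces a segment of a chain running along one directed boundary path of $F$ from $\mathrm{srce}(F)$ to $\mathrm{sink}(F)$ by the other boundary path. For saturated chains $\gamma_1,\gamma_2$ from $u$ to $v$, the sequence of moves $\gamma_1*\gamma_2$ is defined recursively: if $\gamma_1=\gamma_2$ it is trivial. Otherwise let $x$ be the lowest element of $\gamma_1\cap\gamma_2$ covered by distinct elements $a_1\in\gamma_1$, $a_2\in\gamma_2$, and $x'$ the next element of $\gamma_1\cap\gamma_2$ above $x$. Let $F$ be the unique 2-face containing edges $xa_1,xa_2$ (then $\mathrm{sink}(F)=a_1\vee a_2\le x'$). Choose a saturated chain $p$ from $\mathrm{sink}(F)$ to $v$ through $x'$, agreeing with $\gamma_1$ on $[x',v]$, and agreeing with $\gamma_1$ on $[\mathrm{sink}(F),v]$ if $\mathrm{sink}(F)\in\gamma_1$. Let $\gamma_i^F$ follow $\gamma_i$ from $u$ to $a_i$, then the boundary path of $F$ from $a_i$ to $\mathrm{sink}(F)$, then $p$. Then $\gamma_1*\gamma_2$ is: the moves of $\gamma_1*\gamma_1^F$, then the move across $F$ to $\gamma_2^F$,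 then the moves of $\gamma_2^F*\gamma_2$; its nodes are the chains visited. -}

module Defs where

open import Level using (Level; _⊔_) renaming (suc to lsuc)
open import Algebra.Bundles using (CommutativeRing)
open import Relation.Binary.Structures using (IsTotalOrder)
open import Relation.Binary.PropositionalEquality using (_≡_)
open import Relation.Binary.Construct.Closure.ReflexiveTransitive using (Star)
open import Relation.Nullary using (¬_)
open import Data.Nat using (ℕ; zero; suc)
open import Data.Fin using (Fin; zero; suc)
open import Data.Fin.Subset using (Subset; _∈_; _∉_; ∣_∣; ⁅_⁆; _∪_)
open import Data.List using (List; []; _∷_; _++_; [_])
open import Data.List.Membership.Propositional using () renaming (_∈_ to _∈L_)
open import Data.Product using (Σ; ∃; ∃-syntax; _×_; _,_)
open import Data.Sum using (_⊎_)
open import Function.Bundles using (_⇔_)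

record OrderedField (c ℓ : Level) : Set (lsuc (c ⊔ ℓ)) where
  field
    commutativeRing : CommutativeRing c ℓ
  open CommutativeRing commutativeRing public
  field
    _≤_          : Carrier → Carrier → Set ℓ
    0≉1          : ¬ (0# ≈ 1#)
    _⁻¹          : Carrier → Carrier
    ⁻¹-inverse   : ∀ x → ¬ (x ≈ 0#) → x * (x ⁻¹) ≈ 1#
    isTotalOrder : IsTotalOrder _≈_ _≤_
    +-mono-≤     : ∀ {x y} z → x ≤ y → (x + z) ≤ (y + z)
    *-nonneg     : ∀ {x y} → 0# ≤ x → 0# ≤ y → 0# ≤ (x * y)

-- Generic list notions (chains are lists of vertices, bottom first)

module _ {A : Set} where

  Succ : List A → A → A → Set
  Succ γ a b = ∃[ pre ] ∃[ post ] (γ ≡ pre ++ a ∷ b ∷ post)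

  AgreeFrom : A → List A → List A → Set
  AgreeFrom x σ τ = ∃[ s ] ∃[ t ] ∃[ rest ]
    ((σ ≡ s ++ x ∷ rest) × (τ ≡ t ++ x ∷ rest))

-- Geometry of a polytope Q = conv{ p 0, …, p (m-1) } ⊆ K^d with a
-- candidate orientation Dir of its 1-skeleton (Dir x y : edge directed x → y).

module Geometry {c ℓ : Level} (K : OrderedField c ℓ) {d m : ℕ}
                (p : Fin m → Fin d → OrderedField.Carrier K)
                (Dir : Fin m → Fin m → Set) where

  open OrderedField K using (Carrier; _≈_; _≤_; _+_; _*_; 0#)

  V : Set
  V = Fin m

  Σ[_] : ∀ {n} → (Fin n → Carrier) → Carrier
  Σ[_] {zero}  f = 0#
  Σ[_] {suc n} f = f zero + Σ[ (λ i → f (suc i)) ]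

  dot : (Fin d → Carrier) → (Fin d → Carrier) → Carrier
  dot a b = Σ[ (λ t → a t * b t) ]

  -- S ⊆ vertices is (the vertex set of) a nonempty face of Q: the set of
  -- points p j maximising some linear functional c over Q
  IsFace : Subset m → Set (c ⊔ ℓ)
  IsFace S = ∃[ w ] (∀ i → (i ∈ S) ⇔ (∀ j → dot w (p j) ≤ dot w (p i)))

  AffIndep : ∀ {k} → (Fin k → V) → Set (c ⊔ ℓ)
  AffIndep {k} q = ∀ (λ' : Fin k → Carrier) →
    Σ[ λ' ] ≈ 0# →
    (∀ t → Σ[ (λ j → λ' j * p (q j) t) ] ≈ 0#) →
    ∀ j → λ' j ≈ 0#

  Dim : Subset m → ℕ → Set (c ⊔ ℓ)
  Dim S k = (∃[ q ] (AffIndep {suc k} q × (∀ j → q j ∈ S)))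
          × (∀ (q : Fin (suc (suc k)) → V) → (∀ j → q j ∈ S) → ¬ AffIndep q)

  KFace : ℕ → Subset m → Set (c ⊔ ℓ)
  KFace k S = IsFace S × Dim S k

  TwoFace : Subset m → Set (c ⊔ ℓ)
  TwoFace = KFace 2

  Edge : V → V → Set (c ⊔ ℓ)
  Edge x y = KFace 1 (⁅ x ⁆ ∪ ⁅ y ⁆)

  VertexSet : Set (c ⊔ ℓ)
  VertexSet = ∀ i → IsFace ⁅ i ⁆

  data Path : V → V → List V → Set where
    here  : ∀ {x} → Path x x [ x ]
    there : ∀ {x y z ys} → Dir x y → Path y z ys → Path x z (x ∷ ys)

  data FPath (F : Subset m) : V → V → List V → Set where
    here  : ∀ {x} → x ∈ F → FPath F x x [ x ]
    there : ∀ {x y z ys} → Dir x y → x ∈ F → y ∈ F → FPath F y z ys →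
            FPath F x z (x ∷ ys)

  data Dir⁺ : V → V → Set where
    one  : ∀ {x y} → Dir x y → Dir⁺ x y
    more : ∀ {x y z} → Dir x y → Dir⁺ y z → Dir⁺ x z

  IsSource : Subset m → V → Set (c ⊔ ℓ)
  IsSource F x = x ∈ F × (∀ y → y ∈ F → Edge x y → ¬ Dir y x)

  IsSink : Subset m → V → Set (c ⊔ ℓ)
  IsSink F x = x ∈ F × (∀ y → y ∈ F → Edge x y → ¬ Dir x y)

  Unique : (V → Set (c ⊔ ℓ)) → Set (c ⊔ ℓ)
  Unique P = ∃[ x ] (P x × (∀ y → P y → y ≡ x))

  FacialOrientation : Set (c ⊔ ℓ)
  FacialOrientation =
      (∀ x y → Dir x y → Edge x y)
    × (∀ x y → Edge x y → Dir x y ⊎ Dir y x)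
    × (∀ x y → Dir x y → ¬ Dir y x)
    × (∀ x → ¬ Dir⁺ x x)
    × (∀ F → IsFace F → Unique (IsSource F) × Unique (IsSink F))

  -- Q is Dir-directionally simple: for each vertex x, to each set E of
  -- edges directed out of x (given by their upper endpoints) is assigned a
  -- |E|-face containing x and E, distinct sets getting distinct faces
  DirectionallySimple : Set (c ⊔ ℓ)
  DirectionallySimple = ∀ x →
    Σ (Subset m → Subset m) λ φ → ((∀ (E : Subset m) → (∀ y → y ∈ E → Dir x y) →
               KFace ∣ E ∣ (φ E) × x ∈ φ E × (∀ y → y ∈ E → y ∈ φ E))
          × (∀ E E' → (∀ y → y ∈ E → Dir x y) → (∀ y → y ∈ E' → Dir x y) →
               φ E ≡ φ E' → E ≡ E'))

  _≤L_ : V → V → Set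
  _≤L_ = Star Dir

  _<L_ : V → V → Set
  x <L y = x ≤L y × ¬ (x ≡ y)

  IsJoin IsMeet : V → V → V → Set
  IsJoin a b j = a ≤L j × b ≤L j × (∀ z → a ≤L z → b ≤L z → j ≤L z)
  IsMeet a b j = j ≤L a × j ≤L b × (∀ z → z ≤L a → z ≤L b → z ≤L j)

  HasseOfLattice : Set
  HasseOfLattice =
      (∀ x y → Dir x y → ¬ (∃[ z ] (x <L z × z <L y)))
    × (∀ a b → ∃[ j ] IsJoin a b j)
    × (∀ a b → ∃[ j ] IsMeet a b j)

  SatChain : V → V → List V → Set
  SatChain = Path

  Between : V → V → V → Set
  Between a b w = (a ≤L w × w ≤L b) ⊎ (b ≤L w × w ≤L a)

  -- MoveSeq u v γ₁ γ₂ ns : ns is the list of nodes (chains visited) of a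
  -- sequence of moves γ₁ * γ₂ built by the recursive construction
  -- (for some admissible choice of the chains p at each step).
  data MoveSeq (u v : V) : List V → List V → List (List V) → Set (c ⊔ ℓ) where
    trivial : ∀ {γ} → MoveSeq u v γ γ [ γ ]
    step : ∀ {γ₁ γ₂ γ₁F γ₂F ns₁ ns₂}
      → SatChain u v γ₁ → SatChain u v γ₂ → ¬ (γ₁ ≡ γ₂)
      → (x a₁ a₂ : V) (pre₁ pre₂ r₁ r₂ : List V)
      → γ₁ ≡ pre₁ ++ x ∷ a₁ ∷ r₁ → γ₂ ≡ pre₂ ++ x ∷ a₂ ∷ r₂ → ¬ (a₁ ≡ a₂)
      -- x is the lowest element of γ₁ ∩ γ₂ covered by distinct a₁ ∈ γ₁, a₂ ∈ γ₂
      → (∀ y b₁ b₂ → Succ γ₁ y b₁ → Succ γ₂ y b₂ → ¬ (b₁ ≡ b₂) → x ≤L y)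
      → (x' : V) → x' ∈L γ₁ → x' ∈L γ₂ → x <L x'
      → (∀ y → y ∈L γ₁ → y ∈L γ₂ → x <L y → x' ≤L y)
      → (F : Subset m) → TwoFace F → x ∈ F → a₁ ∈ F → a₂ ∈ F
      → (s : V) → IsSink F s
      -- the chain p = s ∷ p' from sink(F) to v through x'
      → (p' : List V) → SatChain s v (s ∷ p') → x' ∈L (s ∷ p')
      → AgreeFrom x' (s ∷ p') γ₁
      → (s ∈L γ₁ → AgreeFrom s (s ∷ p') γ₁)
      -- γᵢ^F : γᵢ up to aᵢ, then the boundary path of F from aᵢ to s, then p
      → (ps₁ ps₂ : List V) → FPath F a₁ s ps₁ → FPath F a₂ s ps₂
      → γ₁F ≡ pre₁ ++ x ∷ ps₁ ++ p' → γ₂F ≡ pre₂ ++ x ∷ ps₂ ++ p'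
      → MoveSeq u v γ₁ γ₁F ns₁
      → MoveSeq u v γ₂F γ₂ ns₂
      → MoveSeq u v γ₁ γ₂ (ns₁ ++ ns₂)

-- Induction on the construction of γ * γ′, for chains that share a prefix ending at x and
-- leave it along distinct edges x a and x a′ (the theorem is the case x = u).  In the first
-- move x is the lowest divergence and F is the 2-face spanned by x a and x a′; the nodes are
-- those of γ * γ^F followed by those of γ′^F * γ′.  Every node of the second part begins with
-- the prefix of γ up to x followed by a′, so its lowest edge outside γ is x a′ itself (r = 0).
-- In the first part, γ^F leaves γ where the boundary path of F departs from γ: it cannot
-- follow γ up to sink F (then γ^F = γ and there are no new nodes), and γ cannot stop before
-- (it ends at v ≥ sink F).  Induction gives a sequence starting at the edge along which γ^F
-- leaves γ at some w, and F links x a′ to it: the stretch of γ from x to w lies on the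
-- boundary path, hence in F.

{-# OPTIONS --safe #-}
module Submission where

open import Defs
open import Level using (Level; _⊔_)
open import Function using (_∘_)
open import Relation.Binary.PropositionalEquality
  using (_≡_; _≢_; refl; sym; trans; cong; subst; module ≡-Reasoning)
open import Relation.Binary.Definitions using (DecidableEquality)
open import Relation.Binary.Construct.Closure.ReflexiveTransitive
  using (_◅_; _◅◅_) renaming (ε to ε★)
open import Relation.Nullary using (¬_; yes; no)
open import Data.Empty using (⊥-elim)
open import Data.Nat using (ℕ; suc)
open import Data.Fin using (Fin; zero; suc; fromℕ; inject₁; _≟_)
open import Data.Fin.Subset using (Subset; _∈_)
open import Data.List using (List; []; _∷_; _++_; [_])
open import Data.List.Properties using (++-assoc; ++-cancelˡ; ∷-injective; ∷-injectiveˡ; ∷-injectiveʳ)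
open import Data.List.Membership.Propositional using () renaming (_∈_ to _∈L_)
open import Data.List.Membership.Propositional.Properties using (∈-++⁺ˡ; ∈-++⁺ʳ; ∈-++⁻; ∈-insert; ∈-∃++)
open import Data.List.Relation.Unary.Any using (here; there)
open import Data.List.Relation.Unary.All using (tabulate)
open import Data.List.Relation.Unary.AllPairs using ([]; _∷_)
open import Data.List.Relation.Unary.Unique.Propositional using (Unique)
open import Data.List.Relation.Unary.Unique.Propositional.Properties using (Unique[x∷xs]⇒x∉xs)
open import Data.Product using (Σ; ∃-syntax; _×_; _,_; proj₁; proj₂; map₂)
open import Data.Sum using (_⊎_; inj₁; inj₂)
import Data.Product as Product
import Data.Sum as Sum
import Data.Vec.Functional as Vector

module _ {A : Set} where

  ∈-split : ∀ {xs : List A} pre {x post} → xs ≡ pre ++ x ∷ post → x ∈L xs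
  ∈-split pre refl = ∈-insert pre

  prefix-∷ʳ-++ : ∀ (pre Q : List A) {x w} post →
    pre ++ [ x ] ≡ Q ++ w → pre ++ x ∷ post ≡ Q ++ (w ++ post)
  prefix-∷ʳ-++ pre Q {x} {w} post eq = begin
    pre ++ x ∷ post      ≡⟨ ++-assoc pre [ x ] post ⟨
    (pre ++ [ x ]) ++ post ≡⟨ cong (_++ post) eq ⟩
    (Q ++ w) ++ post     ≡⟨ ++-assoc Q w post ⟩
    Q ++ (w ++ post)     ∎
    where open ≡-Reasoning

  last-∈-suffix : ∀ (xs ys : List A) {x y zs} → xs ++ [ x ] ≡ ys ++ y ∷ zs → x ∈L y ∷ zs
  last-∈-suffix [] [] refl = here refl
  last-∈-suffix [] (_ ∷ []) ()
  last-∈-suffix [] (_ ∷ _ ∷ _) ()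
  last-∈-suffix (_ ∷ xs) [] eq = there (∈-split xs (sym (∷-injectiveʳ eq)))
  last-∈-suffix (_ ∷ xs) (_ ∷ ys) eq = last-∈-suffix xs ys (∷-injectiveʳ eq)

  ++-∷-split : ∀ (pre : List A) x {xs} mid post → xs ≡ mid ++ post →
    pre ++ x ∷ xs ≡ (pre ++ x ∷ mid) ++ post
  ++-∷-split pre x mid post refl = sym (++-assoc pre (x ∷ mid) post)

  successor-cancel : ∀ pre {x a b : A} {r r′} → pre ++ x ∷ a ∷ r ≡ pre ++ x ∷ b ∷ r′ → a ≡ b
  successor-cancel pre = ∷-injectiveˡ ∘ ∷-injectiveʳ ∘ ++-cancelˡ pre _ _

  Succ-∷⁺ : ∀ {xs : List A} x {a b} → Succ xs a b → Succ (x ∷ xs) a b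
  Succ-∷⁺ x (pre , post , refl) = x ∷ pre , post , refl

  Succ-++⁺ˡ : ∀ {xs : List A} ys {a b} → Succ xs a b → Succ (xs ++ ys) a b
  Succ-++⁺ˡ ys (pre , post , refl) = pre , post ++ ys , ++-assoc pre _ ys

  Succ⇒∈ : ∀ {xs : List A} {a b} → Succ xs a b → a ∈L xs × b ∈L xs
  Succ⇒∈ (pre , _ , refl) = ∈-insert pre , ∈-++⁺ʳ pre (there (here refl))

  Succ-head : ∀ x pre {y z : A} {zs rest} →
    z ∷ zs ≡ pre ++ y ∷ rest → Succ (x ∷ pre ++ [ y ]) x z
  Succ-head x [] refl = [] , [] , refl
  Succ-head x (_ ∷ pre) refl = [] , pre ++ [ _ ] , refl

  Unique-split-injective : ∀ {xs : List A} pre pre′ {x post post′} → Unique xs →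
    xs ≡ pre ++ x ∷ post → xs ≡ pre′ ++ x ∷ post′ → pre ≡ pre′ × post ≡ post′
  Unique-split-injective [] [] _ refl refl = refl , refl
  Unique-split-injective [] (_ ∷ pre′) u refl refl = ⊥-elim (Unique[x∷xs]⇒x∉xs u (∈-insert pre′))
  Unique-split-injective (_ ∷ pre) [] u refl eq
    with refl , _ ← ∷-injective eq = ⊥-elim (Unique[x∷xs]⇒x∉xs u (∈-insert pre))
  Unique-split-injective (_ ∷ pre) (_ ∷ pre′) (_ ∷ u) refl eq
    with refl , eq′ ← ∷-injective eq
    with refl , refl ← Unique-split-injective pre pre′ u refl eq′ = refl , refl

  Unique⇒Succ-deterministic : ∀ {xs : List A} {x a b} → Unique xs → Succ xs x a → Succ xs x b → a ≡ b
  Unique⇒Succ-deterministic u (pre , _ , eq) (pre′ , _ , eq′) =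
    ∷-injectiveˡ (proj₂ (Unique-split-injective pre pre′ u eq eq′))

  ++-split-at-edge : ∀ (Q : List A) {s} pre {x a r} → Q ++ s ≡ pre ++ x ∷ a ∷ r →
    Succ Q x a ⊎ ∃[ w ] (pre ++ [ x ] ≡ Q ++ w)
  ++-split-at-edge [] pre eq = inj₂ (pre ++ [ _ ] , refl)
  ++-split-at-edge (_ ∷ []) [] refl = inj₂ ([] , refl)
  ++-split-at-edge (_ ∷ _ ∷ Q) [] refl = inj₁ ([] , Q , refl)
  ++-split-at-edge (q ∷ Q) (_ ∷ pre) eq with refl , eq′ ← ∷-injective eq =
    Sum.map (Succ-∷⁺ q) (map₂ (cong (q ∷_))) (++-split-at-edge Q pre eq′)

  shared-prefix-below-divergence : ∀ {g g′ : List A} Q {s s′} pre {x a r a′} → Unique g′ →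
    g ≡ Q ++ s → g′ ≡ Q ++ s′ → g ≡ pre ++ x ∷ a ∷ r → Succ g′ x a′ → a ≢ a′ →
    ∃[ w ] (pre ++ [ x ] ≡ Q ++ w)
  shared-prefix-below-divergence Q pre u refl refl eq succ′ a≢a′ with ++-split-at-edge Q pre eq
  ... | inj₁ succ = ⊥-elim (a≢a′ (Unique⇒Succ-deterministic u (Succ-++⁺ˡ _ succ) succ′))
  ... | inj₂ below = below

  AgreeFrom⇒tails-equal : ∀ {xs ys : List A} pre pre′ {s post post′} → Unique xs → Unique ys →
    xs ≡ pre ++ s ∷ post → ys ≡ pre′ ++ s ∷ post′ → AgreeFrom s xs ys → post ≡ post′
  AgreeFrom⇒tails-equal pre pre′ u u′ eq eq′ (t , t′ , _ , e , e′) =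
    trans (proj₂ (Unique-split-injective pre t u eq e))
          (sym (proj₂ (Unique-split-injective pre′ t′ u′ eq′ e′)))

  LowestEdgeOutside : (A → A → Set) → List A → A → A → Set
  LowestEdgeOutside R xs y z = ∃[ pre ] ∃[ rest ]
    (xs ≡ pre ++ y ∷ z ∷ rest × ¬ R y z × (∀ a b → Succ (pre ++ [ y ]) a b → R a b))

  lowest-edge-outside-unique : ∀ {R : A → A → Set} pre pre′ {y z rest y′ z′ rest′} →
    pre ++ y ∷ z ∷ rest ≡ pre′ ++ y′ ∷ z′ ∷ rest′ →
    ¬ R y z → (∀ a b → Succ (pre ++ [ y ]) a b → R a b) →
    ¬ R y′ z′ → (∀ a b → Succ (pre′ ++ [ y′ ]) a b → R a b) → y ≡ y′ × z ≡ z′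
  lowest-edge-outside-unique [] [] refl _ _ _ _ = refl , refl
  lowest-edge-outside-unique [] (q ∷ pre′) eq ¬R _ _ R′
    with refl , eq′ ← ∷-injective eq = ⊥-elim (¬R (R′ _ _ (Succ-head q pre′ eq′)))
  lowest-edge-outside-unique (q ∷ pre) [] eq _ R ¬R′ _
    with refl , eq′ ← ∷-injective (sym eq) = ⊥-elim (¬R′ (R _ _ (Succ-head q pre eq′)))
  lowest-edge-outside-unique (q ∷ pre) (_ ∷ pre′) eq ¬R R ¬R′ R′
    with refl , eq′ ← ∷-injective eq = lowest-edge-outside-unique pre pre′ eq′
      ¬R (λ a b → R a b ∘ Succ-∷⁺ q) ¬R′ (λ a b → R′ a b ∘ Succ-∷⁺ q)

  lowest-edge-outside-at-divergence : ∀ {γ γ₂ : List A} P {x a a′ r s y z} → Unique γ →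
    γ ≡ P ++ x ∷ a ∷ r → γ₂ ≡ P ++ x ∷ a′ ∷ s → a ≢ a′ →
    LowestEdgeOutside (Succ γ) γ₂ y z → y ≡ x × z ≡ a′
  lowest-edge-outside-at-divergence P {x} {a} {r = r} u refl refl a≢a′ (pre , _ , eq , ¬succ , below) =
    lowest-edge-outside-unique pre P (sym eq) ¬succ below
      (λ succ → a≢a′ (Unique⇒Succ-deterministic u (P , r , refl) succ))
      (λ e e′ → subst (λ xs → Succ xs e e′) (++-assoc P [ x ] (a ∷ r)) ∘ Succ-++⁺ˡ (a ∷ r))

  data Comparison (xs ys : List A) : Set where
    ys-prefix        : ∀ zs → xs ≡ ys ++ zs → Comparison xs ys
    xs-proper-prefix : ∀ e es → ys ≡ xs ++ e ∷ es → Comparison xs ys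
    diverge          : ∀ pre w b b′ r r′ → xs ≡ pre ++ w ∷ b ∷ r → ys ≡ pre ++ w ∷ b′ ∷ r′ →
                       b ≢ b′ → Comparison xs ys

  Comparison-∷ : ∀ w {xs ys} → Comparison xs ys → Comparison (w ∷ xs) (w ∷ ys)
  Comparison-∷ w (ys-prefix zs eq) = ys-prefix zs (cong (w ∷_) eq)
  Comparison-∷ w (xs-proper-prefix e es eq) = xs-proper-prefix e es (cong (w ∷_) eq)
  Comparison-∷ w (diverge pre w′ b b′ r r′ eq eq′ b≢b′) =
    diverge (w ∷ pre) w′ b b′ r r′ (cong (w ∷_) eq) (cong (w ∷_) eq′) b≢b′

  compare : DecidableEquality A → ∀ w xs ys → Comparison (w ∷ xs) (w ∷ ys)
  compare _ w xs [] = ys-prefix xs refl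
  compare _ w [] (e ∷ es) = xs-proper-prefix e es refl
  compare _≟_ w (b ∷ xs) (b′ ∷ ys) with b ≟ b′
  ... | no b≢b′ = diverge [] w b b′ xs ys refl refl b≢b′
  ... | yes refl = Comparison-∷ w (compare _≟_ b xs ys)

module Acyclic {c ℓ : Level} (K : OrderedField c ℓ) {d m : ℕ}
  (p : Fin m → Fin d → OrderedField.Carrier K) (Dir : Fin m → Fin m → Set)
  (acyclic : ∀ x → ¬ Geometry.Dir⁺ K p Dir x x) where

  open Geometry K p Dir hiding (Unique)

  _◅⁺_ : ∀ {x y z} → Dir x y → y ≤L z → Dir⁺ x z
  d ◅⁺ ε★ = one d
  d ◅⁺ (d′ ◅ s) = more d (d′ ◅⁺ s)

  _⁺◅◅_ : ∀ {x y z} → Dir⁺ x y → y ≤L z → Dir⁺ x z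
  one d ⁺◅◅ s = d ◅⁺ s
  more d q ⁺◅◅ s = more d (q ⁺◅◅ s)

  Dir⁺⇒≱L : ∀ {x y} → Dir⁺ x y → ¬ y ≤L x
  Dir⁺⇒≱L {x} q s = acyclic x (q ⁺◅◅ s)

  Path⇒≤L : ∀ {x y xs} → Path x y xs → x ≤L y
  Path⇒≤L here = ε★
  Path⇒≤L (there d q) = d ◅ Path⇒≤L q

  Path-∈⇒≥L : ∀ {x y xs q} → Path x y xs → q ∈L xs → x ≤L q
  Path-∈⇒≥L here (here refl) = ε★
  Path-∈⇒≥L here (there ())
  Path-∈⇒≥L (there d q) (here refl) = ε★
  Path-∈⇒≥L (there d q) (there q∈) = d ◅ Path-∈⇒≥L q q∈

  Path⇒end-∈ : ∀ {x y xs} → Path x y xs → y ∈L xs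
  Path⇒end-∈ here = here refl
  Path⇒end-∈ (there _ q) = there (Path⇒end-∈ q)

  Path-head : ∀ {x y xs} → Path x y xs → ∃[ t ] (xs ≡ x ∷ t)
  Path-head here = [] , refl
  Path-head (there _ _) = _ , refl

  Path-last : ∀ {x y xs} → Path x y xs → ∃[ init ] (xs ≡ init ++ [ y ])
  Path-last here = [] , refl
  Path-last (there {x} _ q) = Product.map (x ∷_) (cong (x ∷_)) (Path-last q)

  Path-head⁺ : ∀ {x y xs q} → Path x y (x ∷ xs) → q ∈L xs → Dir⁺ x q
  Path-head⁺ here ()
  Path-head⁺ (there d q) q∈ = d ◅⁺ Path-∈⇒≥L q q∈

  Path-tail : ∀ {u v a b xs} → Path u v (a ∷ b ∷ xs) → Dir a b × Path b v (b ∷ xs)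
  Path-tail (there d here) = d , here
  Path-tail (there d (there d′ q)) = d , there d′ q

  Path-suffix : ∀ pre {u v x xs} → Path u v (pre ++ x ∷ xs) → Path x v (x ∷ xs)
  Path-suffix [] here = here
  Path-suffix [] (there d q) = there d q
  Path-suffix (_ ∷ []) q = proj₂ (Path-tail q)
  Path-suffix (_ ∷ b ∷ pre) q = Path-suffix (b ∷ pre) (proj₂ (Path-tail q))

  Path-Dir : ∀ pre {u v x y xs} → Path u v (pre ++ x ∷ y ∷ xs) → Dir x y
  Path-Dir pre = proj₁ ∘ Path-tail ∘ Path-suffix pre

  Path-later : ∀ pre {u v x xs q} → Path u v (pre ++ x ∷ xs) → q ∈L xs → Dir⁺ x q
  Path-later pre = Path-head⁺ ∘ Path-suffix pre

  Path-earlier : ∀ pre {u v x xs q} → Path u v (pre ++ x ∷ xs) → q ∈L pre → Dir⁺ q x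
  Path-earlier pre {u} {v} {x} {xs} path q∈ with ys , zs , refl ← ∈-∃++ q∈ =
    Path-later ys (subst (Path u v) (++-assoc ys _ (x ∷ xs)) path) (∈-insert zs)

  FPath⇒Path : ∀ {F x y xs} → FPath F x y xs → Path x y xs
  FPath⇒Path (here _) = here
  FPath⇒Path (there d _ _ q) = there d (FPath⇒Path q)

  FPath⇒⊆ : ∀ {F x y xs q} → FPath F x y xs → q ∈L xs → q ∈ F
  FPath⇒⊆ (here x∈) (here refl) = x∈
  FPath⇒⊆ (there _ x∈ _ _) (here refl) = x∈
  FPath⇒⊆ (there _ _ _ q) (there q∈) = FPath⇒⊆ q q∈

  Path⇒Unique : ∀ {x y xs} → Path x y xs → Unique xs
  Path⇒Unique here = tabulate (λ ()) ∷ []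
  Path⇒Unique (there d q) =
    tabulate (λ { q∈ refl → acyclic _ (Path-head⁺ (there d q) q∈) }) ∷ Path⇒Unique q

  Path-overshoot : ∀ {x v s xs e es} → Path x v xs → Path x s (xs ++ e ∷ es) → Dir⁺ v s
  Path-overshoot {xs = xs} γ path =
    Path-earlier xs path (Path⇒end-∈ γ) ⁺◅◅ Path⇒≤L (Path-suffix xs path)

  Path-Between : ∀ pre mid {u v x w post q} → Path u v (pre ++ x ∷ mid ++ w ∷ post) →
    q ∈L pre ++ x ∷ mid ++ w ∷ post → Between x w q → q ≡ x ⊎ q ∈L mid ⊎ q ≡ w
  Path-Between pre mid path q∈ (inj₂ (w≤q , q≤x)) =
    ⊥-elim (Dir⁺⇒≱L (Path-later pre path (∈-++⁺ʳ mid (here refl))) (w≤q ◅◅ q≤x))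
  Path-Between pre mid {u} {v} {x} {w} {post} path q∈ (inj₁ (x≤q , q≤w)) with ∈-++⁻ pre q∈
  ... | inj₁ q∈pre = ⊥-elim (Dir⁺⇒≱L (Path-earlier pre path q∈pre) x≤q)
  ... | inj₂ (here refl) = inj₁ refl
  ... | inj₂ (there q∈rest) with ∈-++⁻ mid q∈rest
  ...   | inj₁ q∈mid = inj₂ (inj₁ q∈mid)
  ...   | inj₂ (here refl) = inj₂ (inj₂ refl)
  ...   | inj₂ (there q∈post) = ⊥-elim (Dir⁺⇒≱L (Path-later (pre ++ x ∷ mid) path′ q∈post) q≤w)
    where
    path′ : Path u v ((pre ++ x ∷ mid) ++ w ∷ post)
    path′ = subst (Path u v) (sym (++-assoc pre (x ∷ mid) (w ∷ post))) path

  FaceLink : List V → Subset m → V × V → V × V → Set (c ⊔ ℓ)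
  FaceLink γ F e e′ = TwoFace F
    × proj₁ e ∈ F × proj₂ e ∈ F
    × proj₁ e′ ∈ F × proj₂ e′ ∈ F
    × (∀ w → w ∈L γ → Between (proj₁ e) (proj₁ e′) w → w ∈ F)
    × (∀ a a′ → Succ γ a a′ → Between (proj₁ e) (proj₁ e′) a → Between (proj₁ e) (proj₁ e′) a′ →
         a ∈ F × a′ ∈ F)

  -- The alternating sequence (ε₀, F₁, ε₁, …, F_r, ε_r) along γ, with Fᵢ₊₁ = Fs i.
  AltSeq : List V → V × V → V × V → Set (c ⊔ ℓ)
  AltSeq γ e e′ = Σ ℕ λ r →
    Σ (Fin (suc r) → V × V) λ ε →
    Σ (Fin r → Subset m) λ Fs →
      (ε zero ≡ e)
    × (ε (fromℕ r) ≡ e′)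
    × (∀ i → Dir (proj₁ (ε i)) (proj₂ (ε i)))
    × (∀ i → proj₁ (ε i) ∈L γ)
    × (∀ i → FaceLink γ (Fs i) (ε (inject₁ i)) (ε (suc i)))

  face-link : ∀ {γ F x a w b} → TwoFace F → x ∈ F → a ∈ F → w ∈ F → b ∈ F →
    (∀ q → q ∈L γ → Between x w q → q ∈ F) → FaceLink γ F (x , a) (w , b)
  face-link 2-face x∈ a∈ w∈ b∈ between⊆F =
    2-face , x∈ , a∈ , w∈ , b∈ , between⊆F ,
    λ a a′ succ a∼ a′∼ → between⊆F a (proj₁ (Succ⇒∈ succ)) a∼ , between⊆F a′ (proj₂ (Succ⇒∈ succ)) a′∼

  AltSeq-refl : ∀ {γ x a} → Dir x a → x ∈L γ → AltSeq γ (x , a) (x , a)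
  AltSeq-refl d x∈ = 0 , (λ _ → _ , _) , (λ ()) , refl , refl , (λ _ → d) , (λ _ → x∈) , (λ ())

  AltSeq-◅ : ∀ {γ F x a e e′} → Dir x a → x ∈L γ → FaceLink γ F (x , a) e → AltSeq γ e e′ →
    AltSeq γ (x , a) e′
  AltSeq-◅ {F = F} {x} {a} d x∈ link (r , ε , Fs , refl , last , dirs , lows , links) =
    suc r , (x , a) Vector.∷ ε , F Vector.∷ Fs , refl , last ,
    (λ { zero → d ; (suc i) → dirs i }) ,
    (λ { zero → x∈ ; (suc i) → lows i }) ,
    (λ { zero → link ; (suc i) → links i })

  MoveSeq-nodes-equal-ends : ∀ {u v g g′ ns n} → MoveSeq u v g g′ ns → g ≡ g′ → n ∈L ns → n ≡ g
  MoveSeq-nodes-equal-ends trivial _ (here refl) = refl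
  MoveSeq-nodes-equal-ends
    (step _ _ g≢g′ _ _ _ _ _ _ _ _ _ _ _ _ _ _ _ _ _ _ _ _ _ _ _ _ _ _ _ _ _ _ _ _ _ _ _ _) g≡g′ _ =
    ⊥-elim (g≢g′ g≡g′)

  MoveSeq-shared-prefix : ∀ {u v g₁ g₂ ns} → MoveSeq u v g₁ g₂ ns →
    ∀ Q {s₁ s₂} → g₁ ≡ Q ++ s₁ → g₂ ≡ Q ++ s₂ → ∀ {n} → n ∈L ns → ∃[ s ] (n ≡ Q ++ s)
  MoveSeq-shared-prefix trivial Q refl _ (here refl) = _ , refl
  MoveSeq-shared-prefix
    (step {ns₁ = ns₁} γ₁↝ γ₂↝ _ x a₁ a₂ pre₁ pre₂ r₁ r₂ eq₁ eq₂ a₁≢a₂ _ _ _ _ _ _ _ _ _ _ _ _ _ p′ _ _ _ _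
          ps₁ ps₂ _ _ eqF₁ eqF₂ moves₁ moves₂)
    Q e₁ e₂ n∈
    with _ , below₁ ← shared-prefix-below-divergence Q pre₁ (Path⇒Unique γ₂↝) e₁ e₂ eq₁
                        (pre₂ , r₂ , eq₂) a₁≢a₂
       | _ , below₂ ← shared-prefix-below-divergence Q pre₂ (Path⇒Unique γ₁↝) e₂ e₁ eq₂
                        (pre₁ , r₁ , eq₁) (a₁≢a₂ ∘ sym)
    with ∈-++⁻ ns₁ n∈
  ... | inj₁ n∈₁ =
    MoveSeq-shared-prefix moves₁ Q e₁ (trans eqF₁ (prefix-∷ʳ-++ pre₁ Q (ps₁ ++ p′) below₁)) n∈₁
  ... | inj₂ n∈₂ =
    MoveSeq-shared-prefix moves₂ Q (trans eqF₂ (prefix-∷ʳ-++ pre₂ Q (ps₂ ++ p′) below₂)) e₂ n∈₂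

  AgreeFrom-end⇒tails-equal : ∀ {x y ps xs} pre post p′ → Path x y ps →
    Unique xs → Unique (y ∷ p′) → xs ≡ pre ++ ps ++ post → (y ∈L xs → AgreeFrom y (y ∷ p′) xs) → p′ ≡ post
  AgreeFrom-end⇒tails-equal {y = y} {xs = xs} pre post p′ path u u′ eq agree
    with init , refl ← Path-last path =
    AgreeFrom⇒tails-equal [] (pre ++ init) u′ u refl xs≡ (agree (∈-split (pre ++ init) xs≡))
    where
    xs≡ : xs ≡ (pre ++ init) ++ y ∷ post
    xs≡ = begin
      xs                            ≡⟨ eq ⟩
      pre ++ (init ++ [ y ]) ++ post ≡⟨ cong (pre ++_) (++-assoc init [ y ] post) ⟩
      pre ++ init ++ y ∷ post       ≡⟨ ++-assoc pre init (y ∷ post) ⟨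
      (pre ++ init) ++ y ∷ post     ∎
      where open ≡-Reasoning

  lowest-divergence : ∀ {u v g g′} P {x s s′} pre {x₀ b b′ t} → Path u v g → Unique g′ →
    g ≡ P ++ x ∷ s → g′ ≡ P ++ x ∷ s′ → g ≡ pre ++ x₀ ∷ b ∷ t → Succ g′ x₀ b′ → b ≢ b′ →
    x₀ ≤L x → pre ≡ P × x₀ ≡ x
  lowest-divergence {u} {v} {g} P {x} {s} {s′} pre {x₀} {b} {t = t} path u′ eq eq′ eq₀ succ′ b≢b′ x₀≤x
    with w , below ← shared-prefix-below-divergence (P ++ [ x ]) pre u′
                       (trans eq (++-∷-split P x [] s refl)) (trans eq′ (++-∷-split P x [] s′ refl))
                       eq₀ succ′ b≢b′
    with last-∈-suffix pre P (trans below (++-assoc P [ x ] w))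
  ... | here refl = proj₁ (Unique-split-injective pre P (Path⇒Unique path) eq₀ eq) , refl
  ... | there x₀∈w = ⊥-elim (Dir⁺⇒≱L (Path-later P (subst (Path u v) g≡ path) (∈-++⁺ˡ x₀∈w)) x₀≤x)
    where
    g≡ : g ≡ P ++ x ∷ w ++ b ∷ t
    g≡ = trans eq₀ (trans (prefix-∷ʳ-++ pre (P ++ [ x ]) (b ∷ t) below)
                          (++-assoc P [ x ] (w ++ b ∷ t)))

  boundary-face-link : ∀ {u v γ F a s ps} pre x C {w b b′ r r′ a′} → Path u v γ →
    γ ≡ pre ++ x ∷ C ++ w ∷ b ∷ r → FPath F a s ps → ps ≡ C ++ w ∷ b′ ∷ r′ →
    TwoFace F → x ∈ F → a′ ∈ F → FaceLink γ F (x , a′) (w , b′)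
  boundary-face-link {F = F} pre x C {w} {b} {b′} {r} path refl ps⊆F ps≡ 2-face x∈F a′∈F =
    face-link 2-face x∈F a′∈F w∈F b′∈F between⊆F
    where
    w∈F : w ∈ F
    w∈F = FPath⇒⊆ ps⊆F (∈-split C ps≡)
    b′∈F : b′ ∈ F
    b′∈F = FPath⇒⊆ ps⊆F (∈-split (C ++ [ w ]) (trans ps≡ (sym (++-assoc C [ w ] _))))
    between⊆F : ∀ q → q ∈L pre ++ x ∷ C ++ w ∷ b ∷ r → Between x w q → q ∈ F
    between⊆F q q∈ btw with Path-Between pre C path q∈ btw
    ... | inj₁ refl = x∈F
    ... | inj₂ (inj₁ q∈C) = FPath⇒⊆ ps⊆F (subst (q ∈L_) (sym ps≡) (∈-++⁺ˡ q∈C))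
    ... | inj₂ (inj₂ refl) = w∈F

  alternating-sequence : ∀ {u v γ γ′ ns} → MoveSeq u v γ γ′ ns →
    ∀ P {x a a′ r r′} → γ ≡ P ++ x ∷ a ∷ r → γ′ ≡ P ++ x ∷ a′ ∷ r′ → a ≢ a′ →
    ∀ {γ₂ y z} → γ₂ ∈L ns → γ₂ ≢ γ → LowestEdgeOutside (Succ γ) γ₂ y z → AltSeq γ (x , a′) (y , z)
  alternating-sequence trivial P refl eq′ a≢a′ _ _ _ = ⊥-elim (a≢a′ (successor-cancel P eq′))
  alternating-sequence
    (step {γ₁F = γ₁F} {ns₁ = ns₁} γ↝ γ′↝ _ x₀ a₁ a₂ pre₁ pre₂ r₁ r₂ eq₁ eq₂ a₁≢a₂ x₀-lowest _ _ _ _ _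
          F 2-face x₀∈F _ a₂∈F s _ p′ s↝v _ _ agree-at-s ps₁ ps₂ ps₁⊆F ps₂⊆F eqF₁ eqF₂ moves₁ moves₂)
    P {x} {a} {a′} {r} {r′} refl refl a≢a′ γ₂∈ γ₂≢γ new
    with refl , refl ← lowest-divergence P pre₁ γ↝ (Path⇒Unique γ′↝) refl refl eq₁ (pre₂ , r₂ , eq₂) a₁≢a₂
                         (x₀-lowest x a a′ (P , r , refl) (P , r′ , refl) a≢a′)
    with refl , _ ← lowest-divergence P pre₂ γ′↝ (Path⇒Unique γ↝) refl refl eq₂ (P , r₁ , eq₁) (a₁≢a₂ ∘ sym) ε★
    with refl ← successor-cancel P eq₁
    with refl ← successor-cancel P eq₂
    with ∈-++⁻ ns₁ γ₂∈
  ... | inj₂ γ₂∈ns₂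
    with S₂ , refl ← Path-head (FPath⇒Path ps₂⊆F)
    with s′ , refl ← MoveSeq-shared-prefix moves₂ (P ++ x ∷ [ a′ ])
                       (trans eqF₂ (++-∷-split P x [ a′ ] _ refl)) (++-∷-split P x [ a′ ] r′ refl) γ₂∈ns₂
    with refl , refl ← lowest-edge-outside-at-divergence P (Path⇒Unique γ↝) refl (++-assoc P _ s′) a≢a′ new
    = AltSeq-refl (Path-Dir P γ′↝) (∈-insert P)
  ... | inj₁ γ₂∈ns₁
    with S , refl ← Path-head (FPath⇒Path ps₁⊆F)
    with compare _≟_ a r S
  ... | ys-prefix T′ refl = ⊥-elim (γ₂≢γ (MoveSeq-nodes-equal-ends moves₁ (sym γ₁F≡γ) γ₂∈ns₁))
    where
    -- γ runs along the boundary path up to sink F, so by the choice of p it agrees with γ^F.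
    γ₁F≡γ : γ₁F ≡ P ++ x ∷ a ∷ S ++ T′
    γ₁F≡γ = trans eqF₁ (cong (λ t → P ++ x ∷ a ∷ S ++ t)
      (AgreeFrom-end⇒tails-equal (P ++ [ x ]) T′ p′ (FPath⇒Path ps₁⊆F) (Path⇒Unique γ↝)
        (Path⇒Unique s↝v) (++-∷-split P x [] _ refl) agree-at-s))
  ... | xs-proper-prefix e es refl =
    ⊥-elim (Dir⁺⇒≱L (Path-overshoot (proj₂ (Path-tail (Path-suffix P γ↝))) (FPath⇒Path ps₁⊆F))
                    (Path⇒≤L s↝v))
  ... | diverge C w c c′ r₁′ r₂′ r≡ S≡ c≢c′ =
    AltSeq-◅ (Path-Dir P γ′↝) (∈-insert P)
      (boundary-face-link P x C γ↝ (cong (λ l → P ++ x ∷ l) r≡) ps₁⊆F S≡ 2-face x₀∈F a₂∈F)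
      (alternating-sequence moves₁ (P ++ x ∷ C) (++-∷-split P x C _ r≡)
        (trans eqF₁ (++-∷-split P x C _ (trans (cong (_++ p′) S≡) (++-assoc C _ p′))))
        c≢c′ γ₂∈ns₁ γ₂≢γ new)

lemma4p4 : ∀ {c ℓ : Level} (K : OrderedField c ℓ) (d m : ℕ)
    (p : Fin m → Fin d → OrderedField.Carrier K)
    (Dir : Fin m → Fin m → Set) →
    let open Geometry K p Dir in
    VertexSet → FacialOrientation → DirectionallySimple → HasseOfLattice →
    ∀ (u v : Fin m) (γ γ₁ : List (Fin m)) →
    SatChain u v γ → SatChain u v γ₁ →
    ∀ (b b₁ : Fin m) (t t₁ : List (Fin m)) →
    γ ≡ u ∷ b ∷ t → γ₁ ≡ u ∷ b₁ ∷ t₁ → ¬ (b ≡ b₁) →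
    ∀ (ns : List (List (Fin m))) → MoveSeq u v γ γ₁ ns →
    ∀ (γ₂ : List (Fin m)) → γ₂ ∈L ns → ¬ (γ₂ ≡ γ) →
    ∀ (pre : List (Fin m)) (y z : Fin m) (rest : List (Fin m)) →
    γ₂ ≡ pre ++ y ∷ z ∷ rest → ¬ Succ γ y z →
    (∀ a a' → Succ (pre ++ [ y ]) a a' → Succ γ a a') →
    Σ ℕ λ r →
    Σ (Fin (suc r) → Fin m × Fin m) λ ε →
    Σ (Fin r → Subset m) λ Fs →
      (ε zero ≡ (u , b₁))
    × (ε (fromℕ r) ≡ (y , z))
    × (∀ i → Dir (proj₁ (ε i)) (proj₂ (ε i)))
    × (∀ i → proj₁ (ε i) ∈L γ)
    × (∀ (i : Fin r) →
          TwoFace (Fs i)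
        × proj₁ (ε (inject₁ i)) ∈ Fs i × proj₂ (ε (inject₁ i)) ∈ Fs i
        × proj₁ (ε (suc i)) ∈ Fs i × proj₂ (ε (suc i)) ∈ Fs i
        × (∀ w → w ∈L γ → Between (proj₁ (ε (inject₁ i))) (proj₁ (ε (suc i))) w →
             w ∈ Fs i)
        × (∀ a a' → Succ γ a a' →
             Between (proj₁ (ε (inject₁ i))) (proj₁ (ε (suc i))) a →
             Between (proj₁ (ε (inject₁ i))) (proj₁ (ε (suc i))) a' →
             a ∈ Fs i × a' ∈ Fs i))
lemma4p4 K d m p Dir _ (_ , _ , _ , acyclic , _) _ _ u v γ γ₁ _ _ b b₁ t t₁ γ≡ γ₁≡ b≢b₁
         ns moves γ₂ γ₂∈ns γ₂≢γ pre y z rest γ₂≡ yz∉γ below-in-γ =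
  Acyclic.alternating-sequence K p Dir acyclic moves [] γ≡ γ₁≡ b≢b₁ γ₂∈ns γ₂≢γ
    (pre , rest , γ₂≡ , yz∉γ , below-in-γ)
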